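{- Let $D$ be a minimal strong digraph of order $n\geq 3$. Then there is a sequence of strong digraphs $D=D_n, D_{n-1},\dots,D_2$, where $D_k$ has order $k$ and $D_2$ is the directed $2$-cycle, such that for each $k=3,\dots,n$ the digraph $D_{k-1}$ is a reduction of $D_k$; that is, $D$ can be reduced to the cycle $C_2$ by a sequence of $n-2$ reductions.
   Context: A digraph is a pair $D=(V,A)$ with $V$ a finite nonempty set and $A\subseteq V\times V\setminus\{(x,x):x\in V\}$; the arc $(x,y)$ is written $xy$. A digraph is strong if for every ordered pair of vertices $x,y$ there is a directed path from $x$ to $y$. A strong digraph is minimal strong if deleting any single arc yields a digraph that is not strong. The directed $2$-cycle $C_2$ has two vertices $a,b$ and arcs $ab,ba$. For a digraph $D=(V,A)$ and a vertex $v\notin V$: the internal expansion of $D$ by $v$ over the arc $uw\in A$ is $(V\cup\{v\},\,(A\cup\{uv,vw\})\setminus\{uw\})$; the external expansion of $D$ by $v$ from $u\in V$ to $w\in V$ ($u,w$ not necessarily distinct) is $(V\cup\{v\},\,A\cup\{uv,vw\})$. A strong digraph $D$ is a reduction of a strong digraph $D^*$ if $D^*$ is an internal or an external expansion of $D$ (by some new vertex). -}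

module Defs where

open import Data.Nat using (ℕ; suc; pred; _≤_)
open import Data.Bool using (Bool; true; false; _∧_; _∨_; not)
open import Data.Fin using (Fin; _≟_)
open import Data.Fin.Subset using (Subset; _∈_; _∉_; _∪_; ⁅_⁆; ⊤; ∣_∣)
open import Data.Product using (Σ; _×_; ∃; ∃-syntax)
open import Data.Sum using (_⊎_)
open import Relation.Nullary using (¬_; ⌊_⌋)
open import Relation.Binary.PropositionalEquality using (_≡_; _≢_)

-- Digraphs are modelled with vertex set a subset of Fin n (the ambient
-- vertex universe) and arcs given by a Boolean-valued relation.
Arcs : ℕ → Set
Arcs n = Fin n → Fin n → Bool

_==_ : ∀ {n} → Fin n → Fin n → Bool
x == y = ⌊ x ≟ y ⌋

isArc : ∀ {n} → Fin n → Fin n → Fin n → Fin n → Bool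
isArc u w x y = (x == u) ∧ (y == w)

record Digraph (n : ℕ) : Set where
  field
    V : Subset n
    A : Arcs n
    arcs-in : ∀ x y → A x y ≡ true → (x ∈ V) × (y ∈ V)
    loopless : ∀ x → A x x ≡ false
open Digraph public

data Path {n : ℕ} (A : Arcs n) : Fin n → Fin n → Set where
  here : ∀ {x} → Path A x x
  step : ∀ {x y z} → A x y ≡ true → Path A y z → Path A x z

StrongOn : ∀ {n} → Subset n → Arcs n → Set
StrongOn V A = ∀ x y → x ∈ V → y ∈ V → Path A x y

Strong : ∀ {n} → Digraph n → Set
Strong D = StrongOn (V D) (A D)

deleteArc : ∀ {n} → Arcs n → Fin n → Fin n → Arcs n
deleteArc A u w x y = A x y ∧ not (isArc u w x y)

MinimalStrongOn : ∀ {n} → Subset n → Arcs n → Set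
MinimalStrongOn V A =
  StrongOn V A × (∀ u w → A u w ≡ true → ¬ StrongOn V (deleteArc A u w))

order : ∀ {n} → Digraph n → ℕ
order D = ∣ V D ∣

internalArcs : ∀ {n} → Arcs n → Fin n → Fin n → Fin n → Arcs n
internalArcs A u v w x y =
  (A x y ∨ isArc u v x y ∨ isArc v w x y) ∧ not (isArc u w x y)

externalArcs : ∀ {n} → Arcs n → Fin n → Fin n → Fin n → Arcs n
externalArcs A u v w x y = A x y ∨ isArc u v x y ∨ isArc v w x y

IsInternalExpansion : ∀ {n} → Digraph n → Digraph n → Fin n → Set
IsInternalExpansion D Dstar v =
  ∃[ u ] ∃[ w ] (A D u w ≡ true ×
    (∀ x y → A Dstar x y ≡ internalArcs (A D) u v w x y))

IsExternalExpansion : ∀ {n} → Digraph n → Digraph n → Fin n → Set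
IsExternalExpansion D Dstar v =
  ∃[ u ] ∃[ w ] (u ∈ V D × w ∈ V D ×
    (∀ x y → A Dstar x y ≡ externalArcs (A D) u v w x y))

IsReduction : ∀ {n} → Digraph n → Digraph n → Set
IsReduction D Dstar =
  Strong D × Strong Dstar ×
  (∃[ v ] (v ∉ V D × V Dstar ≡ V D ∪ ⁅ v ⁆ ×
     (IsInternalExpansion D Dstar v ⊎ IsExternalExpansion D Dstar v)))

IsC2 : ∀ {n} → Digraph n → Set
IsC2 D = ∃[ a ] ∃[ b ] (a ≢ b × V D ≡ ⁅ a ⁆ ∪ ⁅ b ⁆ ×
  (∀ x y → A D x y ≡ (isArc a b x y ∨ isArc b a x y)))

module Submission where

-- A minimal strong digraph D of order at least 2 has an ear
-- decomposition whose last ear  x → v₁ → … → vₖ → y  leaves a strongly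
-- connected induced subdigraph D[S] (with x, y ∈ S) and covers every vertex
-- outside S.  Minimality of D forces its arcs to be exactly the arcs of D[S]
-- together with those of the ear, and D[S] is again minimal strong.
-- Conversely D is rebuilt from D[S] by one external expansion (adding vₖ from
-- x to y) followed by k - 1 internal expansions (adding vₖ₋₁, …, v₁ in turn
-- just after x).  By induction on the order, every minimal strong digraph is
-- therefore the top of a chain of expansions starting from a single vertex;
-- the members of this chain of orders n, n - 1, …, 2 form the required
-- sequence, and its member of order 2 is the directed 2-cycle because every
-- expansion of a one-vertex digraph is.

open import Defs
open import Data.Nat using (ℕ; zero; suc; pred; _+_; _≤_; _<_; z≤n; s≤s)
open import Data.Nat.Properties
  using (≤-refl; ≤-trans; ≤-reflexive; ≤-antisym; ≤-pred; <-irrefl; ≰⇒>; _≤?_;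
         ≤∧≢⇒<; n≤1+n; m≤n+m; +-suc; +-monoˡ-≤; +-identityʳ; suc-injective)
  renaming (_≟_ to _≟ℕ_)
open import Data.Bool using (true; false; _∧_; _∨_; not)
open import Data.Bool.Properties using (∨-comm; ∨-assoc; ∧-identityʳ; ∧-zeroʳ)
open import Data.Fin using (Fin; _≟_)
open import Data.Fin.Properties using (any?)
open import Data.Fin.Subset
  using (Subset; _∈_; _∉_; _∪_; ⁅_⁆; ⊤; ∣_∣; _⊆_; inside; outside)
  renaming (⊥ to ∅)
open import Data.Fin.Subset.Properties
  using (_∈?_; x∈p∪q⁺; x∈p∪q⁻; x∈⁅x⁆; x∈⁅y⁆⇒x≡y; ∪-identityʳ; ⊆-antisym;
         p⊂q⇒∣p∣<∣q∣; p⊆q⇒∣p∣≤∣q∣; ∣⊥∣≡0; ∣⁅x⁆∣≡1; ∈⊤; ∣⊤∣≡n)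
open import Data.Vec using (_∷_; here; there)
open import Data.List using (List; []; _∷_)
open import Data.List.Membership.Propositional using () renaming (_∈_ to _∈ₗ_)
open import Data.List.Relation.Unary.Any using (here; there)
import Data.List.Relation.Unary.Any as Any
open import Data.List.Relation.Unary.All using (All; []; _∷_)
import Data.List.Relation.Unary.All as All
open import Data.List.Relation.Unary.All.Properties using (¬Any⇒All¬; All¬⇒¬Any)
open import Data.List.Relation.Unary.Unique.Propositional using (Unique; []; _∷_)
open import Data.Product using (Σ; _×_; _,_; proj₁; proj₂; ∃)
import Data.Product as Product
open import Data.Sum using (_⊎_; inj₁; inj₂; [_,_])
import Data.Sum
open import Data.Empty using (⊥; ⊥-elim)
open import Function using (_∘_)
open import Relation.Nullary using (¬_; Dec; yes; no; ¬?; ⌊_⌋)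
open import Relation.Nullary.Decidable using (decidable-stable; _×-dec_)
open import Relation.Binary.PropositionalEquality
  using (_≡_; _≢_; refl; sym; trans; cong; subst; subst₂; module ≡-Reasoning)

∨-split : ∀ {a b} → a ∨ b ≡ true → a ≡ true ⊎ b ≡ true
∨-split {true} _ = inj₁ refl
∨-split {false} e = inj₂ e

∨-introˡ : ∀ {a} b → a ≡ true → a ∨ b ≡ true
∨-introˡ b refl = refl

∨-introʳ : ∀ a {b} → b ≡ true → a ∨ b ≡ true
∨-introʳ true _ = refl
∨-introʳ false e = e

∧-split : ∀ {a b} → a ∧ b ≡ true → a ≡ true × b ≡ true
∧-split {true} {true} _ = refl , refl

∧-intro : ∀ {a b} → a ≡ true → b ≡ true → a ∧ b ≡ true
∧-intro refl refl = refl

true≢false : ∀ {a} → a ≡ true → a ≡ false → ⊥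
true≢false refl ()

¬true⇒false : ∀ {a} → ¬ a ≡ true → a ≡ false
¬true⇒false {true} ¬t = ⊥-elim (¬t refl)
¬true⇒false {false} _ = refl

bool-ext : ∀ {a b} → (a ≡ true → b ≡ true) → (b ≡ true → a ≡ true) → a ≡ b
bool-ext {true} a⇒b _ = sym (a⇒b refl)
bool-ext {false} {true} _ b⇒a = b⇒a refl
bool-ext {false} {false} _ _ = refl

∨-rearrange : ∀ r w a b → (r ∨ w) ∨ a ∨ b ≡ r ∨ a ∨ b ∨ w
∨-rearrange true _ _ _ = refl
∨-rearrange false w a b = trans (∨-comm w (a ∨ b)) (∨-assoc a b w)

-- Replacing an arc t by arcs a and b: the arcs r ∨ t ∨ w with a, b added and t
-- removed are r ∨ a ∨ b ∨ w, provided t (when present) is not among the latter.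
splice : ∀ r t w a b → (t ≡ true → r ∨ a ∨ b ∨ w ≡ false) →
  ((r ∨ t ∨ w) ∨ a ∨ b) ∧ not t ≡ r ∨ a ∨ b ∨ w
splice r false w a b _ = trans (∧-identityʳ _) (∨-rearrange r w a b)
splice r true w a b absent = trans (∧-zeroʳ _) (sym (absent refl))

dec-sound : ∀ {P : Set} (d : Dec P) → ⌊ d ⌋ ≡ true → P
dec-sound (yes p) _ = p

dec-complete : ∀ {P : Set} (d : Dec P) → P → ⌊ d ⌋ ≡ true
dec-complete (yes _) _ = refl
dec-complete (no ¬p) p = ⊥-elim (¬p p)

isArc-sound : ∀ {n} (u w : Fin n) {x y} → isArc u w x y ≡ true → x ≡ u × y ≡ w
isArc-sound u w {x} {y} e =
  let (x=u , y=w) = ∧-split e in dec-sound (x ≟ u) x=u , dec-sound (y ≟ w) y=w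

isArc-refl : ∀ {n} (u w : Fin n) → isArc u w u w ≡ true
isArc-refl u w = ∧-intro (dec-complete (u ≟ u) refl) (dec-complete (w ≟ w) refl)

isArc-elsewhere : ∀ {n} (u w : Fin n) {x y} → ¬ (x ≡ u × y ≡ w) → isArc u w x y ≡ false
isArc-elsewhere u w ne = ¬true⇒false (ne ∘ isArc-sound u w)

not-isArc : ∀ {n} (u w x y : Fin n) → ¬ (x ≡ u × y ≡ w) → not (isArc u w x y) ≡ true
not-isArc u w x y ne = cong not (isArc-elsewhere u w ne)

∣∪⁅⁆∣ : ∀ {n} (S : Subset n) v → v ∉ S → ∣ S ∪ ⁅ v ⁆ ∣ ≡ suc ∣ S ∣
∣∪⁅⁆∣ (inside ∷ S) Fin.zero v∉ = ⊥-elim (v∉ here)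
∣∪⁅⁆∣ (outside ∷ S) Fin.zero _ = cong suc (cong ∣_∣ (∪-identityʳ S))
∣∪⁅⁆∣ (inside ∷ S) (Fin.suc v) v∉ = cong suc (∣∪⁅⁆∣ S v (v∉ ∘ there))
∣∪⁅⁆∣ (outside ∷ S) (Fin.suc v) v∉ = ∣∪⁅⁆∣ S v (v∉ ∘ there)

module _ {n : ℕ} where

  _⊆ₐ_ : Arcs n → Arcs n → Set
  B ⊆ₐ C = ∀ x y → B x y ≡ true → C x y ≡ true

  _∪ₐ_ : Arcs n → Arcs n → Arcs n
  (B ∪ₐ C) x y = B x y ∨ C x y

  _≐_ : Arcs n → Arcs n → Set
  B ≐ C = ∀ x y → B x y ≡ C x y

  induced : Arcs n → Subset n → Arcs n
  induced B S x y = B x y ∧ ⌊ x ∈? S ⌋ ∧ ⌊ y ∈? S ⌋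

  induced-sound : ∀ {B S x y} → induced B S x y ≡ true → B x y ≡ true × x ∈ S × y ∈ S
  induced-sound {S = S} {x} {y} e =
    let (xy , ends) = ∧-split e ; (x∈ , y∈) = ∧-split ends
    in xy , dec-sound (x ∈? S) x∈ , dec-sound (y ∈? S) y∈

  induced-intro : ∀ {B S x y} → B x y ≡ true → x ∈ S → y ∈ S → induced B S x y ≡ true
  induced-intro {S = S} {x} {y} xy x∈ y∈ =
    ∧-intro xy (∧-intro (dec-complete (x ∈? S) x∈) (dec-complete (y ∈? S) y∈))

  induced-mono : ∀ {B S T} → S ⊆ T → induced B S ⊆ₐ induced B T
  induced-mono {B} {S} {T} S⊆T x y e =
    let (xy , x∈ , y∈) = induced-sound {B} {S} e in induced-intro {B} {T} xy (S⊆T x∈) (S⊆T y∈)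

  ⊆-deleteArc : ∀ {B C u w} → B ⊆ₐ C → (∀ {x y} → B x y ≡ true → ¬ (x ≡ u × y ≡ w)) →
    B ⊆ₐ deleteArc C u w
  ⊆-deleteArc {u = u} {w} B⊆C avoids x y e = ∧-intro (B⊆C x y e) (not-isArc u w x y (avoids e))

  ⊆-deleteArc-absent : ∀ {B C u w} → B ⊆ₐ C → B u w ≡ false → B ⊆ₐ deleteArc C u w
  ⊆-deleteArc-absent B⊆C uw∉ = ⊆-deleteArc B⊆C λ { e (refl , refl) → true≢false e uw∉ }

  deleteArc-mono : ∀ {B C u w} → B ⊆ₐ C → deleteArc B u w ⊆ₐ deleteArc C u w
  deleteArc-mono B⊆C x y e = let (xy , kept) = ∧-split e in ∧-intro (B⊆C x y xy) kept

  outside-or-⊆ : (T X : Subset n) → (∃ λ t → t ∈ T × t ∉ X) ⊎ T ⊆ X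
  outside-or-⊆ T X with any? (λ t → (t ∈? T) ×-dec ¬? (t ∈? X))
  ... | yes witness = inj₁ witness
  ... | no none = inj₂ λ {z} z∈T → decidable-stable (z ∈? X) (λ z∉X → none (z , z∈T , z∉X))

  element-of : (S : Subset n) → 1 ≤ ∣ S ∣ → ∃ (_∈ S)
  element-of S 1≤ with outside-or-⊆ S ∅
  ... | inj₁ (s , s∈ , _) = s , s∈
  ... | inj₂ S⊆∅ with ≤-trans 1≤ (≤-trans (p⊆q⇒∣p∣≤∣q∣ S⊆∅) (≤-reflexive (∣⊥∣≡0 n)))
  ...   | ()

  ⁅⁆⊆ : ∀ {S : Subset n} {s} → s ∈ S → ⁅ s ⁆ ⊆ S
  ⁅⁆⊆ {S} {s} s∈ m = subst (_∈ S) (sym (x∈⁅y⁆⇒x≡y s m)) s∈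

  ∈⇒1≤∣∣ : ∀ {S : Subset n} {s} → s ∈ S → 1 ≤ ∣ S ∣
  ∈⇒1≤∣∣ {S} {s} s∈ = subst (_≤ ∣ S ∣) (∣⁅x⁆∣≡1 s) (p⊆q⇒∣p∣≤∣q∣ (⁅⁆⊆ s∈))

  singleton-of : (S : Subset n) → ∣ S ∣ ≡ 1 → ∃ λ s → S ≡ ⁅ s ⁆
  singleton-of S one with element-of S (≤-reflexive (sym one))
  ... | s , s∈ = s , ⊆-antisym S⊆s (⁅⁆⊆ s∈)
    where
    S⊆s : S ⊆ ⁅ s ⁆
    S⊆s with outside-or-⊆ S ⁅ s ⁆
    ... | inj₂ S⊆s = S⊆s
    ... | inj₁ (t , t∈ , t∉) =
      ⊥-elim (<-irrefl refl (subst₂ _<_ (∣⁅x⁆∣≡1 s) one (p⊂q⇒∣p∣<∣q∣ (⁅⁆⊆ s∈ , t , t∈ , t∉))))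

  ∪⁅⁆-split : ∀ {S : Subset n} {v z} → z ∈ S ∪ ⁅ v ⁆ → z ∈ S ⊎ z ≡ v
  ∪⁅⁆-split {S} {v} m with x∈p∪q⁻ S ⁅ v ⁆ m
  ... | inj₁ z∈S = inj₁ z∈S
  ... | inj₂ z∈v = inj₂ (x∈⁅y⁆⇒x≡y v z∈v)

  ∪⁅⁆-old : ∀ {S : Subset n} {v z} → z ∈ S → z ∈ S ∪ ⁅ v ⁆
  ∪⁅⁆-old z∈S = x∈p∪q⁺ (inj₁ z∈S)

  ∪⁅⁆-new : ∀ {S : Subset n} {v} → v ∈ S ∪ ⁅ v ⁆
  ∪⁅⁆-new {v = v} = x∈p∪q⁺ (inj₂ (x∈⁅x⁆ v))

  _∪ₗ_ : Subset n → List (Fin n) → Subset n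
  S ∪ₗ [] = S
  S ∪ₗ (v ∷ vs) = (S ∪ₗ vs) ∪ ⁅ v ⁆

  ∪ₗ-split : ∀ {S} vs {z} → z ∈ S ∪ₗ vs → z ∈ S ⊎ z ∈ₗ vs
  ∪ₗ-split [] m = inj₁ m
  ∪ₗ-split (v ∷ vs) m with ∪⁅⁆-split m
  ... | inj₂ refl = inj₂ (here refl)
  ... | inj₁ m′ = Data.Sum.map₂ there (∪ₗ-split vs m′)

  ∪ₗ-old : ∀ {S} vs → S ⊆ S ∪ₗ vs
  ∪ₗ-old [] z∈S = z∈S
  ∪ₗ-old (v ∷ vs) z∈S = ∪⁅⁆-old (∪ₗ-old vs z∈S)

  ∪ₗ-new : ∀ {S} vs {z} → z ∈ₗ vs → z ∈ S ∪ₗ vs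
  ∪ₗ-new (v ∷ vs) (here refl) = ∪⁅⁆-new
  ∪ₗ-new (v ∷ vs) (there m) = ∪⁅⁆-old (∪ₗ-new vs m)

  _++ₚ_ : ∀ {B : Arcs n} {x y z} → Path B x y → Path B y z → Path B x z
  here ++ₚ q = q
  step e p ++ₚ q = step e (p ++ₚ q)

  mapPath : ∀ {B C : Arcs n} → B ⊆ₐ C → ∀ {x y} → Path B x y → Path C x y
  mapPath B⊆C here = here
  mapPath B⊆C (step e p) = step (B⊆C _ _ e) (mapPath B⊆C p)

  strong-mono : ∀ {S B C} → StrongOn S B → B ⊆ₐ C → StrongOn S C
  strong-mono S-strong B⊆C x y x∈ y∈ = mapPath B⊆C (S-strong x y x∈ y∈)

  exit-arc : ∀ {B} (S : Subset n) {a b} → Path B a b → a ∈ S → b ∉ S →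
    Σ (Fin n) λ x → Σ (Fin n) λ v → x ∈ S × v ∉ S × B x v ≡ true
  exit-arc S here a∈ b∉ = ⊥-elim (b∉ a∈)
  exit-arc S {a} (step {y = c} e p) a∈ b∉ with c ∈? S
  ... | yes c∈ = exit-arc S p c∈ b∉
  ... | no c∉ = a , c , a∈ , c∉ , e

  expansion-strong : ∀ {S B C u v w} → StrongOn S B → (∀ {a b} → Path B a b → Path C a b) →
    u ∈ S → w ∈ S → C u v ≡ true → C v w ≡ true → StrongOn (S ∪ ⁅ v ⁆) C
  expansion-strong {S} {B} {C} {u} {v} {w} S-strong transport u∈ w∈ uv vw a b a∈ b∈ =
    let (a′ , a′∈ , a→a′) = into-S (∪⁅⁆-split a∈)
        (b′ , b′∈ , b′→b) = out-of-S (∪⁅⁆-split b∈)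
    in a→a′ ++ₚ (transport (S-strong a′ b′ a′∈ b′∈) ++ₚ b′→b)
    where
    into-S : ∀ {z} → z ∈ S ⊎ z ≡ v → Σ (Fin n) λ z′ → z′ ∈ S × Path C z z′
    into-S (inj₁ z∈) = _ , z∈ , here
    into-S (inj₂ refl) = w , w∈ , step vw here
    out-of-S : ∀ {z} → z ∈ S ⊎ z ≡ v → Σ (Fin n) λ z′ → z′ ∈ S × Path C z′ z
    out-of-S (inj₁ z∈) = _ , z∈ , here
    out-of-S (inj₂ refl) = u , u∈ , step uv here

  externalArcs-cases : ∀ {B : Arcs n} {u v w x y} → externalArcs B u v w x y ≡ true →
    B x y ≡ true ⊎ (x ≡ u × y ≡ v) ⊎ (x ≡ v × y ≡ w)
  externalArcs-cases {u = u} {v} {w} e with ∨-split e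
  ... | inj₁ old = inj₁ old
  ... | inj₂ new = inj₂ (Data.Sum.map (isArc-sound u v) (isArc-sound v w) (∨-split new))

  externalArcs-in : (D : Digraph n) {u v w : Fin n} → u ∈ V D → w ∈ V D → ∀ x y →
    externalArcs (A D) u v w x y ≡ true → x ∈ V D ∪ ⁅ v ⁆ × y ∈ V D ∪ ⁅ v ⁆
  externalArcs-in D u∈ w∈ x y e with externalArcs-cases {A D} e
  ... | inj₁ old = Product.map ∪⁅⁆-old ∪⁅⁆-old (arcs-in D x y old)
  ... | inj₂ (inj₁ (refl , refl)) = ∪⁅⁆-old u∈ , ∪⁅⁆-new
  ... | inj₂ (inj₂ (refl , refl)) = ∪⁅⁆-new , ∪⁅⁆-old w∈

  externalArcs-loopless : (D : Digraph n) {u v w : Fin n} → u ∈ V D → w ∈ V D → v ∉ V D →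
    ∀ x → externalArcs (A D) u v w x x ≡ false
  externalArcs-loopless D {u} {v} {w} u∈ w∈ v∉ x = ¬true⇒false loop
    where
    loop : ¬ externalArcs (A D) u v w x x ≡ true
    loop e with externalArcs-cases {A D} e
    ... | inj₁ old = true≢false old (loopless D x)
    ... | inj₂ (inj₁ (refl , refl)) = v∉ u∈
    ... | inj₂ (inj₂ (refl , refl)) = v∉ w∈

  externalExpansion : (D : Digraph n) (u v w : Fin n) → u ∈ V D → w ∈ V D → v ∉ V D → Digraph n
  externalExpansion D u v w u∈ w∈ v∉ = record
    { V = V D ∪ ⁅ v ⁆
    ; A = externalArcs (A D) u v w
    ; arcs-in = externalArcs-in D u∈ w∈
    ; loopless = externalArcs-loopless D u∈ w∈ v∉
    }

  external-reduction : (D : Digraph n) (u v w : Fin n)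
    (u∈ : u ∈ V D) (w∈ : w ∈ V D) (v∉ : v ∉ V D) → Strong D → IsReduction D (externalExpansion D u v w u∈ w∈ v∉)
  external-reduction D u v w u∈ w∈ v∉ D-strong =
    D-strong , expanded-strong , v , v∉ , refl , inj₂ (u , w , u∈ , w∈ , λ _ _ → refl)
    where
    expanded-strong : Strong (externalExpansion D u v w u∈ w∈ v∉)
    expanded-strong = expansion-strong D-strong (mapPath λ x y → ∨-introˡ _) u∈ w∈
      (∨-introʳ (A D u v) (∨-introˡ _ (isArc-refl u v)))
      (∨-introʳ (A D v w) (∨-introʳ (isArc u v v w) (isArc-refl v w)))

  internalExpansion : (D : Digraph n) (u v w : Fin n) → A D u w ≡ true → v ∉ V D → Digraph n
  internalExpansion D u v w uw v∉ = record
    { V = V D ∪ ⁅ v ⁆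
    ; A = internalArcs (A D) u v w
    ; arcs-in = λ x y e → externalArcs-in D u∈ w∈ x y (proj₁ (∧-split e))
    ; loopless = λ x → ¬true⇒false λ e →
        true≢false (proj₁ (∧-split e)) (externalArcs-loopless D u∈ w∈ v∉ x)
    }
    where
    u∈ : u ∈ V D
    u∈ = proj₁ (arcs-in D u w uw)
    w∈ : w ∈ V D
    w∈ = proj₂ (arcs-in D u w uw)

  internal-reduction : (D : Digraph n) (u v w : Fin n) (uw : A D u w ≡ true) (v∉ : v ∉ V D) →
    Strong D → IsReduction D (internalExpansion D u v w uw v∉)
  internal-reduction D u v w uw v∉ D-strong =
    D-strong , expansion-strong D-strong reroute u∈ w∈ uv vw , v , v∉ , refl ,
    inj₁ (u , w , uw , λ _ _ → refl)
    where
    u∈ : u ∈ V D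
    u∈ = proj₁ (arcs-in D u w uw)
    w∈ : w ∈ V D
    w∈ = proj₂ (arcs-in D u w uw)
    C : Arcs n
    C = internalArcs (A D) u v w
    kept : ∀ {x y} → A D x y ≡ true → ¬ (x ≡ u × y ≡ w) → C x y ≡ true
    kept {x} {y} xy ≢uw = ∧-intro (∨-introˡ _ xy) (not-isArc u w x y ≢uw)
    uv : C u v ≡ true
    uv = ∧-intro (∨-introʳ (A D u v) (∨-introˡ _ (isArc-refl u v)))
                 (not-isArc u w u v λ { (_ , refl) → v∉ w∈ })
    vw : C v w ≡ true
    vw = ∧-intro (∨-introʳ (A D v w) (∨-introʳ (isArc u v v w) (isArc-refl v w)))
                 (not-isArc u w v w λ { (refl , _) → v∉ u∈ })
    -- every arc survives except uw, which is replaced by u → v → w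
    reroute : ∀ {a b} → Path (A D) a b → Path C a b
    reroute here = here
    reroute (step {x} {y} xy p) with x ≟ u | y ≟ w
    ... | yes refl | yes refl = step uv (step vw (reroute p))
    ... | yes _ | no y≢w = step (kept xy (y≢w ∘ proj₂)) (reroute p)
    ... | no x≢u | _ = step (kept xy (x≢u ∘ proj₁)) (reroute p)

  reduction-order : ∀ {D′ D : Digraph n} → IsReduction D′ D → order D ≡ suc (order D′)
  reduction-order {D′} (_ , _ , v , v∉ , V-eq , _) = trans (cong ∣_∣ V-eq) (∣∪⁅⁆∣ (V D′) v v∉)

  point-expansion-is-C2 : ∀ {D′ D : Digraph n} → IsReduction D′ D → order D′ ≡ 1 → IsC2 D
  point-expansion-is-C2 {D′} {D} (_ , _ , v , v∉ , V-eq , how) one with singleton-of (V D′) one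
  ... | s , V≡s = s , v , s≢v , trans V-eq (cong (_∪ ⁅ v ⁆) V≡s) , arcs how
    where
    only-s : ∀ {z} → z ∈ V D′ → z ≡ s
    only-s m = x∈⁅y⁆⇒x≡y s (subst (_ ∈_) V≡s m)
    s≢v : s ≢ v
    s≢v refl = v∉ (subst (s ∈_) (sym V≡s) (x∈⁅x⁆ s))
    -- an arc of D′ would be a loop at s
    no-arcs : ∀ x y → A D′ x y ≡ false
    no-arcs x y = ¬true⇒false λ e → let (x∈ , y∈) = arcs-in D′ x y e in
      true≢false (subst (λ z → A D′ x z ≡ true) (trans (only-s y∈) (sym (only-s x∈))) e)
                 (loopless D′ x)
    arcs : IsInternalExpansion D′ D v ⊎ IsExternalExpansion D′ D v →
      ∀ x y → A D x y ≡ (isArc s v x y ∨ isArc v s x y)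
    arcs (inj₁ (u , w , uw , _)) = ⊥-elim (true≢false uw (no-arcs u w))
    arcs (inj₂ (u , w , u∈ , w∈ , A-eq)) x y
      rewrite only-s u∈ | only-s w∈ | A-eq x y | no-arcs x y = refl

  data ReductionChain : Digraph n → Set where
    single : ∀ {D} → order D ≡ 1 → Strong D → ReductionChain D
    expand : ∀ {D′ D} → IsReduction D′ D → ReductionChain D′ → ReductionChain D

  chain-strong : ∀ {D} → ReductionChain D → Strong D
  chain-strong (single _ D-strong) = D-strong
  chain-strong (expand (_ , D-strong , _) _) = D-strong

  -- The member of order k of a chain (the top digraph when k exceeds its order).
  member : ∀ {D} → ReductionChain D → ℕ → Digraph n
  member {D} (single _ _) k = D
  member {D} (expand _ c) k with order D ≤? k
  ... | yes _ = D
  ... | no _ = member c k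

  -- Members below the top of a chain lie in the chain of the first reduction.
  reduction-below : ∀ {D′ D : Digraph n} {k} → IsReduction D′ D → ¬ order D ≤ k → k ≤ order D′
  reduction-below {D′} {D} r ≰k = ≤-pred (subst (_ <_) (reduction-order {D′} {D} r) (≰⇒> ≰k))

  member-top : ∀ {D} (c : ReductionChain D) → member c (order D) ≡ D
  member-top (single _ _) = refl
  member-top {D} (expand _ c) with order D ≤? order D
  ... | yes _ = refl
  ... | no ≰ = ⊥-elim (≰ ≤-refl)

  member-order : ∀ {D} (c : ReductionChain D) k → 1 ≤ k → k ≤ order D →
    order (member c k) ≡ k × Strong (member c k)
  member-order (single one D-strong) k 1≤k k≤ = ≤-antisym (subst (_≤ k) (sym one) 1≤k) k≤ , D-strong
  member-order {D} (expand {D′} r c) k 1≤k k≤ with order D ≤? k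
  ... | yes ≤k = ≤-antisym ≤k k≤ , proj₁ (proj₂ r)
  ... | no ≰k = member-order c k 1≤k (reduction-below {D′} {D} r ≰k)

  member-reduction : ∀ {D} (c : ReductionChain D) k → 1 ≤ k → suc k ≤ order D →
    IsReduction (member c k) (member c (suc k))
  member-reduction (single one _) k (s≤s _) sk≤ with ≤-trans sk≤ (≤-reflexive one)
  ... | s≤s ()
  member-reduction {D} (expand {D′} r c) k 1≤k sk≤ with order D ≤? suc k | order D ≤? k
  ... | _ | yes ≤k = ⊥-elim (<-irrefl refl (≤-trans sk≤ ≤k))
  ... | yes ≤sk | no _ = subst (λ X → IsReduction X D) (sym below-is-D′) r
    where
    below-is-D′ : member c k ≡ D′
    below-is-D′ = subst (λ j → member c j ≡ D′)
      (suc-injective (trans (sym (reduction-order {D′} {D} r)) (≤-antisym ≤sk sk≤))) (member-top c)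
  ... | no ≰sk | no _ = member-reduction c k 1≤k (reduction-below {D′} {D} r ≰sk)

  member-C2 : ∀ {D} (c : ReductionChain D) → 2 ≤ order D → IsC2 (member c 2)
  member-C2 c 2≤ = point-expansion-is-C2 {member c 1} {member c 2}
    (member-reduction c 1 ≤-refl 2≤) (proj₁ (member-order c 1 ≤-refl (≤-trans (n≤1+n 1) 2≤)))

  data Walk (B : Arcs n) : Fin n → List (Fin n) → Fin n → Set where
    arc : ∀ {a y} → B a y ≡ true → Walk B a [] y
    _∷ʷ_ : ∀ {a v vs y} → B a v ≡ true → Walk B v vs y → Walk B a (v ∷ vs) y

  walkArcs : Fin n → List (Fin n) → Fin n → Arcs n
  walkArcs a [] y = isArc a y
  walkArcs a (v ∷ vs) y = isArc a v ∪ₐ walkArcs v vs y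

  walk-source : ∀ a vs y {c d} → walkArcs a vs y c d ≡ true → c ≡ a ⊎ c ∈ₗ vs
  walk-source a [] y e = inj₁ (proj₁ (isArc-sound a y e))
  walk-source a (v ∷ vs) y e with ∨-split e
  ... | inj₁ first = inj₁ (proj₁ (isArc-sound a v first))
  ... | inj₂ later = inj₂ ([ here , there ] (walk-source v vs y later))

  walk-touches : ∀ a v vs y {c d} → walkArcs a (v ∷ vs) y c d ≡ true →
    c ∈ₗ (v ∷ vs) ⊎ d ∈ₗ (v ∷ vs)
  walk-touches a v vs y e with ∨-split e
  ... | inj₁ first = inj₂ (here (proj₂ (isArc-sound a v first)))
  ... | inj₂ later = inj₁ ([ here , there ] (walk-source v vs y later))

  module _ {B : Arcs n} where

    walkArcs-⊆ : ∀ {a vs y} → Walk B a vs y → walkArcs a vs y ⊆ₐ B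
    walkArcs-⊆ {a} {y = y} (arc ay) c d e with isArc-sound a y {c} {d} e
    ... | refl , refl = ay
    walkArcs-⊆ {a} (_∷ʷ_ {v = v} av walk) c d e with ∨-split e
    ... | inj₂ later = walkArcs-⊆ walk c d later
    ... | inj₁ first with isArc-sound a v {c} {d} first
    ...   | refl , refl = av

    walk-of : ∀ a vs y → walkArcs a vs y ⊆ₐ B → Walk B a vs y
    walk-of a [] y arcs = arc (arcs a y (isArc-refl a y))
    walk-of a (v ∷ vs) y arcs = arcs a v (∨-introˡ _ (isArc-refl a v)) ∷ʷ
      walk-of v vs y (λ c d e → arcs c d (∨-introʳ (isArc a v c d) e))

    walk-path : ∀ {a vs y} → Walk B a vs y → Path B a y
    walk-path (arc ay) = step ay here
    walk-path (av ∷ʷ walk) = step av (walk-path walk)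

    walk-prefix : ∀ {a vs y z} → Walk B a vs y → z ∈ₗ vs → Path B a z
    walk-prefix (av ∷ʷ _) (here refl) = step av here
    walk-prefix (av ∷ʷ walk) (there m) = step av (walk-prefix walk m)

    walk-suffix : ∀ {a vs y z} → Walk B a vs y → z ∈ₗ vs → Path B z y
    walk-suffix (_ ∷ʷ walk) (here refl) = walk-path walk
    walk-suffix (_ ∷ʷ walk) (there m) = walk-suffix walk m

    walk-induced : ∀ {T a vs y} → Walk B a vs y → a ∈ T → y ∈ T → All (_∈ T) vs →
      Walk (induced B T) a vs y
    walk-induced {T} (arc ay) a∈ y∈ [] = arc (induced-intro {B} {T} ay a∈ y∈)
    walk-induced {T} (av ∷ʷ walk) a∈ y∈ (v∈ ∷ vs∈) =
      induced-intro {B} {T} av a∈ v∈ ∷ʷ walk-induced walk v∈ y∈ vs∈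

    ear-strong : ∀ {S x vs y} → StrongOn S B → x ∈ S → y ∈ S → Walk B x vs y →
      StrongOn (S ∪ₗ vs) B
    ear-strong {S} {x} {vs} {y} S-strong x∈ y∈ walk a b a∈ b∈ =
      let (a′ , a′∈ , a→a′) = into-S (∪ₗ-split vs a∈)
          (b′ , b′∈ , b′→b) = out-of-S (∪ₗ-split vs b∈)
      in a→a′ ++ₚ (S-strong a′ b′ a′∈ b′∈ ++ₚ b′→b)
      where
      into-S : ∀ {z} → z ∈ S ⊎ z ∈ₗ vs → Σ (Fin n) λ z′ → z′ ∈ S × Path B z z′
      into-S (inj₁ z∈) = _ , z∈ , here
      into-S (inj₂ z∈vs) = y , y∈ , walk-suffix walk z∈vs
      out-of-S : ∀ {z} → z ∈ S ⊎ z ∈ₗ vs → Σ (Fin n) λ z′ → z′ ∈ S × Path B z′ z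
      out-of-S (inj₁ z∈) = _ , z∈ , here
      out-of-S (inj₂ z∈vs) = x , x∈ , walk-prefix walk z∈vs

    walk-from : ∀ {S a c ws y} → Walk B c ws y → a ∈ₗ ws → All (_∉ S) ws → Unique ws →
      Σ (List (Fin n)) λ ws′ → Walk B a ws′ y × All (_∉ S) ws′ × Unique (a ∷ ws′)
    walk-from (_ ∷ʷ walk) (here refl) (_ ∷ out) distinct = _ , walk , out , distinct
    walk-from (_ ∷ʷ walk) (there m) (_ ∷ out) (_ ∷ distinct) = walk-from walk m out distinct

  walk-vertex : (D : Digraph n) → ∀ {a vs y z} → Walk (A D) a vs y → z ∈ₗ vs → z ∈ V D
  walk-vertex D (av ∷ʷ _) (here refl) = proj₂ (arcs-in D _ _ av)
  walk-vertex D (_ ∷ʷ walk) (there m) = walk-vertex D walk m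

  return-walk : (D : Digraph n) (S : Subset n) → ∀ {a b} → Path (A D) a b → b ∈ S → a ∉ S →
    Σ (Fin n) λ y → Σ (List (Fin n)) λ ws →
      y ∈ S × Walk (A D) a ws y × All (_∉ S) ws × Unique (a ∷ ws)
  return-walk D S here b∈ a∉ = ⊥-elim (a∉ b∈)
  return-walk D S {a} (step {y = c} ac p) b∈ a∉ with c ∈? S
  ... | yes c∈ = c , [] , c∈ , arc ac , [] , [] ∷ []
  ... | no c∉ with return-walk D S p b∈ c∉
  ...   | y , ws , y∈ , walk , out , distinct with Any.any? (a ≟_) (c ∷ ws)
  ...     | no a∉walk = y , c ∷ ws , y∈ , ac ∷ʷ walk , c∉ ∷ out , ¬Any⇒All¬ _ a∉walk ∷ distinct
  ...     | yes (here refl) = ⊥-elim (true≢false ac (loopless D a))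
  ...     | yes (there a∈ws) with distinct
  ...       | _ ∷ distinct-ws with walk-from walk a∈ws out distinct-ws
  ...         | ws′ , walk′ , out′ , distinct′ = y , ws′ , y∈ , walk′ , out′ , distinct′

  record Ear (D : Digraph n) (S : Subset n) : Set where
    field
      start end v₁ : Fin n
      vs : List (Fin n)
      start∈S : start ∈ S
      end∈S : end ∈ S
      on-D : Walk (A D) start (v₁ ∷ vs) end
      inner∉S : All (_∉ S) (v₁ ∷ vs)
      distinct : Unique (v₁ ∷ vs)

    inner : List (Fin n)
    inner = v₁ ∷ vs

  find-ear : (D : Digraph n) → Strong D → ∀ {S s t} → S ⊆ V D → s ∈ S → t ∈ V D → t ∉ S → Ear D S
  find-ear D D-strong {S} S⊆V s∈ t∈ t∉ with exit-arc S (D-strong _ _ (S⊆V s∈) t∈) s∈ t∉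
  ... | x , v , x∈ , v∉ , xv
    with return-walk D S (D-strong v x (proj₂ (arcs-in D x v xv)) (S⊆V x∈)) x∈ v∉
  ...   | y , ws , y∈ , walk , out , distinct = record
    { start = x ; end = y ; v₁ = v ; vs = ws ; start∈S = x∈ ; end∈S = y∈
    ; on-D = xv ∷ʷ walk ; inner∉S = v∉ ∷ out ; distinct = distinct }

  -- The last step of an ear decomposition: a strongly connected induced
  -- subdigraph D[S] and one ear at S covering all remaining vertices.
  record EarDecomposition (D : Digraph n) : Set where
    field
      S : Subset n
      S-strong : StrongOn S (induced (A D) S)
      ear : Ear D S
    open Ear ear public
    field
      covers : V D ≡ S ∪ₗ inner

  -- Grow a strongly connected induced subdigraph by ears until one ear covers
  -- the remaining vertices; the budget b bounds the number of steps.
  grow : (D : Digraph n) → Strong D → (b : ℕ) (S : Subset n) → S ⊆ V D → ∀ {s t} → s ∈ S →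
    StrongOn S (induced (A D) S) → t ∈ V D → t ∉ S → order D ≤ ∣ S ∣ + b → EarDecomposition D
  grow D _ zero S S⊆V _ _ t∈ t∉ bound = ⊥-elim (<-irrefl refl
    (≤-trans (p⊂q⇒∣p∣<∣q∣ (S⊆V , _ , t∈ , t∉)) (≤-trans bound (≤-reflexive (+-identityʳ ∣ S ∣)))))
  grow D D-strong (suc b) S S⊆V s∈ S-strong t∈ t∉ bound = continue (outside-or-⊆ (V D) S′)
    where
    E : Ear D S
    E = find-ear D D-strong S⊆V s∈ t∈ t∉
    open Ear E
    S′ : Subset n
    S′ = S ∪ₗ inner
    S′⊆V : S′ ⊆ V D
    S′⊆V m = [ S⊆V , walk-vertex D on-D ] (∪ₗ-split inner m)
    S′-strong : StrongOn S′ (induced (A D) S′)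
    S′-strong = ear-strong (strong-mono S-strong (induced-mono {A D} {S} (∪ₗ-old inner)))
      start∈S end∈S
      (walk-induced on-D (∪ₗ-old inner start∈S) (∪ₗ-old inner end∈S) (All.tabulate (∪ₗ-new inner)))
    bound′ : order D ≤ ∣ S′ ∣ + b
    bound′ = ≤-trans bound (≤-trans (≤-reflexive (+-suc ∣ S ∣ b))
      (+-monoˡ-≤ b (p⊂q⇒∣p∣<∣q∣ (∪ₗ-old inner , v₁ , ∪ₗ-new inner (here refl) , All.head inner∉S))))
    continue : (∃ λ t → t ∈ V D × t ∉ S′) ⊎ V D ⊆ S′ → EarDecomposition D
    continue (inj₂ V⊆S′) = record
      { S = S ; S-strong = S-strong ; ear = E ; covers = ⊆-antisym V⊆S′ S′⊆V }
    continue (inj₁ (t′ , t′∈ , t′∉)) =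
      grow D D-strong b S′ S′⊆V (∪ₗ-old inner s∈) S′-strong t′∈ t′∉ bound′

  ear-decomposition : (D : Digraph n) → Strong D → 2 ≤ order D → EarDecomposition D
  ear-decomposition D D-strong 2≤ with element-of (V D) (≤-trans (n≤1+n 1) 2≤)
  ... | a , a∈ with outside-or-⊆ (V D) ⁅ a ⁆
  ...   | inj₂ V⊆a with ≤-trans 2≤ (≤-trans (p⊆q⇒∣p∣≤∣q∣ V⊆a) (≤-reflexive (∣⁅x⁆∣≡1 a)))
  ...     | s≤s ()
  ear-decomposition D D-strong 2≤ | a , a∈ | inj₁ (t , t∈ , t∉) =
    grow D D-strong (order D) ⁅ a ⁆ (⁅⁆⊆ a∈) (x∈⁅x⁆ a) a-strong t∈ t∉ (m≤n+m (order D) ∣ ⁅ a ⁆ ∣)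
    where
    a-strong : StrongOn ⁅ a ⁆ (induced (A D) ⁅ a ⁆)
    a-strong x y x∈ y∈ rewrite x∈⁅y⁆⇒x≡y a x∈ | x∈⁅y⁆⇒x≡y a y∈ = here

  WithEar : Digraph n → Fin n → List (Fin n) → Fin n → Set
  WithEar E x vs y = Σ (Digraph n) λ G →
    ReductionChain G × V G ≡ V E ∪ₗ vs × A G ≐ (A E ∪ₐ walkArcs x vs y)

  -- An ear with new, distinct inner vertices is attached to the top E of a
  -- reduction chain by one external expansion (its last inner vertex, from x
  -- to y) followed by internal expansions just after x (the other inner
  -- vertices, from last to first).
  attach-ear : ∀ {E} → ReductionChain E → ∀ {x y} → x ∈ V E → y ∈ V E →
    ∀ v vs → All (_∉ V E) (v ∷ vs) → Unique (v ∷ vs) → WithEar E x (v ∷ vs) y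
  attach-ear {E} c {x} {y} x∈ y∈ v [] (v∉ ∷ []) _ =
    externalExpansion E x v y x∈ y∈ v∉ ,
    expand (external-reduction E x v y x∈ y∈ v∉ (chain-strong c)) c , refl , λ _ _ → refl
  attach-ear {E} c {x} {y} x∈ y∈ q (v ∷ vs) (q∉E ∷ new) (q∉ ∷ distinct)
    with attach-ear c x∈ y∈ v vs new distinct
  ... | G , c′ , V-G , A-G =
    internalExpansion G x q v xv q∉G ,
    expand (internal-reduction G x q v xv q∉G (chain-strong c′)) c′ ,
    cong (_∪ ⁅ q ⁆) V-G , arcs
    where
    xv : A G x v ≡ true
    xv = trans (A-G x v) (∨-introʳ (A E x v) (∨-introˡ _ (isArc-refl x v)))
    q∉G : q ∉ V G
    q∉G m = [ q∉E , All¬⇒¬Any q∉ ] (∪ₗ-split (v ∷ vs) (subst (q ∈_) V-G m))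
    -- the arc x → v, replaced by x → q → v, occurs nowhere in the new arc set
    xv-replaced : ∀ {c d} → isArc x v c d ≡ true →
      (A E ∪ₐ walkArcs x (q ∷ v ∷ vs) y) c d ≡ false
    xv-replaced {c} {d} e with isArc-sound x v {c} {d} e
    ... | refl , refl = ¬true⇒false absent
      where
      absent : ¬ (A E ∪ₐ walkArcs x (q ∷ v ∷ vs) y) x v ≡ true
      absent e′ with ∨-split e′
      ... | inj₁ old = All.head new (proj₂ (arcs-in E x v old))
      ... | inj₂ e₁ with ∨-split e₁
      ...   | inj₁ xq = All.head q∉ (sym (proj₂ (isArc-sound x q {x} {v} xq)))
      ...   | inj₂ e₂ with ∨-split e₂
      ...     | inj₁ qv = q∉E (subst (_∈ V E) (proj₁ (isArc-sound q v {x} {v} qv)) x∈)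
      ...     | inj₂ later =
        [ (λ x≡v → All.head new (subst (_∈ V E) x≡v x∈))
        , (λ x∈vs → All.lookup (All.tail new) x∈vs x∈) ] (walk-source v vs y later)
    arcs : internalArcs (A G) x q v ≐ (A E ∪ₐ walkArcs x (q ∷ v ∷ vs) y)
    arcs c d =
      trans (cong (λ b → (b ∨ isArc x q c d ∨ isArc q v c d) ∧ not (isArc x v c d)) (A-G c d))
            (splice (A E c d) (isArc x v c d) (walkArcs v vs y c d) (isArc x q c d)
                    (isArc q v c d) xv-replaced)

  module LastEar (D : Digraph n) (minimal : MinimalStrongOn (V D) (A D)) (2≤ : 2 ≤ order D) where
    open EarDecomposition (ear-decomposition D (proj₁ minimal) 2≤) public

    core : Arcs n
    core = induced (A D) S

    earArcs : Arcs n
    earArcs = walkArcs start inner end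

    core⊆D : core ⊆ₐ A D
    core⊆D x y e = proj₁ (induced-sound {A D} {S} e)

    strong-with-ear : ∀ {B C} → StrongOn S B → B ⊆ₐ C → earArcs ⊆ₐ C → StrongOn (V D) C
    strong-with-ear {C = C} B-strong B⊆C ear⊆C = subst (λ T → StrongOn T C) (sym covers)
      (ear-strong (strong-mono B-strong B⊆C) start∈S end∈S (walk-of start inner end ear⊆C))

    -- By minimality, the arcs of D are exactly the core arcs and the ear arcs.
    arcs-split : ∀ x y → A D x y ≡ core x y ∨ earArcs x y
    arcs-split x y =
      bool-ext only-core-or-ear λ e → [ core⊆D x y , walkArcs-⊆ on-D x y ] (∨-split e)
      where
      only-core-or-ear : A D x y ≡ true → core x y ∨ earArcs x y ≡ true
      only-core-or-ear xy with core x y in in-core | earArcs x y in in-ear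
      ... | true | _ = refl
      ... | false | true = refl
      ... | false | false = ⊥-elim (proj₂ minimal x y xy (strong-with-ear S-strong
        (⊆-deleteArc-absent {core} {A D} {x} {y} core⊆D in-core)
        (⊆-deleteArc-absent {earArcs} {A D} {x} {y} (walkArcs-⊆ on-D) in-ear)))

    -- Every ear arc has an end outside S, so it is never a core arc.
    ear-avoids-core : ∀ {u w} → core u w ≡ true → ∀ {x y} → earArcs x y ≡ true → ¬ (x ≡ u × y ≡ w)
    ear-avoids-core uw e (refl , refl)
      with induced-sound {A D} {S} uw | walk-touches start v₁ vs end e
    ... | _ , u∈ , _ | inj₁ u∈inner = All.lookup inner∉S u∈inner u∈
    ... | _ , _ , w∈ | inj₂ w∈inner = All.lookup inner∉S w∈inner w∈

    core-minimal : MinimalStrongOn S core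
    core-minimal = S-strong , λ u w uw core-strong → proj₂ minimal u w (core⊆D u w uw)
      (strong-with-ear core-strong (deleteArc-mono {core} {A D} {u} {w} core⊆D)
        (⊆-deleteArc {earArcs} {A D} {u} {w} (walkArcs-⊆ on-D) (ear-avoids-core uw)))

    coreDigraph : Digraph n
    coreDigraph = record
      { V = S
      ; A = core
      ; arcs-in = λ x y e → proj₂ (induced-sound {A D} {S} e)
      ; loopless = λ x → ¬true⇒false λ e → true≢false (core⊆D x x e) (loopless D x)
      }

    core-smaller : order coreDigraph < order D
    core-smaller = p⊂q⇒∣p∣<∣q∣
      ( (λ m → subst (_ ∈_) (sym covers) (∪ₗ-old inner m))
      , v₁ , subst (v₁ ∈_) (sym covers) (∪ₗ-new inner (here refl)) , All.head inner∉S )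

  Reducible : Digraph n → Set
  Reducible D = Σ (Digraph n) λ E → ReductionChain E × V E ≡ V D × A E ≐ A D

  -- Every minimal strong digraph is reducible: by induction on a bound b on
  -- its order, it is rebuilt from its (reducible) core by re-attaching the last ear.
  minimal-strong-reducible : ∀ b (D : Digraph n) → order D ≤ b → 1 ≤ order D →
    MinimalStrongOn (V D) (A D) → Reducible D
  minimal-strong-reducible zero D ≤0 1≤ _ with ≤-trans 1≤ ≤0
  ... | ()
  minimal-strong-reducible (suc b) D ≤b 1≤ minimal with order D ≟ℕ 1
  ... | yes one = D , single one (proj₁ minimal) , refl , λ _ _ → refl
  ... | no ≢1 = rebuild (minimal-strong-reducible b coreDigraph (≤-pred (≤-trans core-smaller ≤b))
                          (∈⇒1≤∣∣ start∈S) core-minimal)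
    where
    open LastEar D minimal (≤∧≢⇒< 1≤ (≢1 ∘ sym))
    rebuild : Reducible coreDigraph → Reducible D
    rebuild (E , c , V-E , A-E) =
      finish (attach-ear c (in-E start∈S) (in-E end∈S) v₁ vs inner∉E distinct)
      where
      in-E : ∀ {z} → z ∈ S → z ∈ V E
      in-E = subst (_ ∈_) (sym V-E)
      inner∉E : All (_∉ V E) inner
      inner∉E = All.map (λ z∉S z∈E → z∉S (subst (_ ∈_) V-E z∈E)) inner∉S
      finish : WithEar E start inner end → Reducible D
      finish (G , c′ , V-G , A-G) =
        G , c′ , trans V-G (trans (cong (_∪ₗ inner) V-E) (sym covers)) , arcs
        where
        open ≡-Reasoning
        arcs : A G ≐ A D
        arcs x y = begin
          A G x y                 ≡⟨ A-G x y ⟩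
          A E x y ∨ earArcs x y   ≡⟨ cong (_∨ earArcs x y) (A-E x y) ⟩
          core x y ∨ earArcs x y  ≡⟨ sym (arcs-split x y) ⟩
          A D x y                 ∎

corollary3p6 : (n : ℕ) → 3 ≤ n → (Arc : Arcs n) → (∀ x → Arc x x ≡ false) →
    MinimalStrongOn ⊤ Arc →
    Σ (ℕ → Digraph n) λ Ds → ((V (Ds n) ≡ ⊤ × (∀ x y → A (Ds n) x y ≡ Arc x y)) ×
      (∀ k → 2 ≤ k → k ≤ n → order (Ds k) ≡ k × Strong (Ds k)) ×
      IsC2 (Ds 2) ×
      (∀ k → 3 ≤ k → k ≤ n → IsReduction (Ds (pred k)) (Ds k)))
corollary3p6 n 3≤n Arc loop minimal =
  member c , (trans (cong V top) V-E , λ x y → trans (cong (λ G → A G x y) top) (A-E x y)) ,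
  orders , member-C2 c (≤-trans (n≤1+n 2) at-least-3) , reductions
  where
  D : Digraph n
  D = record { V = ⊤ ; A = Arc ; arcs-in = λ _ _ _ → ∈⊤ , ∈⊤ ; loopless = loop }
  reducible : Reducible D
  reducible = minimal-strong-reducible n D (≤-reflexive (∣⊤∣≡n n))
    (≤-trans (s≤s z≤n) (≤-trans 3≤n (≤-reflexive (sym (∣⊤∣≡n n))))) minimal
  E : Digraph n
  E = proj₁ reducible
  c : ReductionChain E
  c = proj₁ (proj₂ reducible)
  V-E : V E ≡ ⊤
  V-E = proj₁ (proj₂ (proj₂ reducible))
  A-E : A E ≐ Arc
  A-E = proj₂ (proj₂ (proj₂ reducible))
  order-E : order E ≡ n
  order-E = trans (cong ∣_∣ V-E) (∣⊤∣≡n n)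
  at-least-3 : 3 ≤ order E
  at-least-3 = ≤-trans 3≤n (≤-reflexive (sym order-E))
  top : member c n ≡ E
  top = subst (λ k → member c k ≡ E) order-E (member-top c)
  orders : ∀ k → 2 ≤ k → k ≤ n → order (member c k) ≡ k × Strong (member c k)
  orders k 2≤k k≤n =
    member-order c k (≤-trans (n≤1+n 1) 2≤k) (≤-trans k≤n (≤-reflexive (sym order-E)))
  reductions : ∀ k → 3 ≤ k → k ≤ n → IsReduction (member c (pred k)) (member c k)
  reductions (suc k) (s≤s 2≤k) sk≤n =
    member-reduction c k (≤-trans (n≤1+n 1) 2≤k) (≤-trans sk≤n (≤-reflexive (sym order-E)))
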